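{- Let $\mathcal{E}=(E,\boxplus,',\mathbf{0},\mathbf{1})$ be a lattice-ordered QMV algebra with lattice meet $\wedge$. Then: (i) for every $\mathcal{E}$-valued non-deterministic Turing machine $M$ and every input $s\in\Sigma^+$, $|M|_w(s)\le |M|_d(s)$; (ii) $|M|_w=|M|_d$ holds for every $\mathcal{E}$-valued non-deterministic Turing machine $M$ if and only if $\mathcal{E}$ is an MV algebra.
   Context: An S-algebra is $(E,\boxplus,',\mathbf{0},\mathbf{1})$ with a binary operation $\boxplus$, unary $'$, constants $\mathbf 0,\mathbf 1$, satisfying $a\boxplus b=b\boxplus a$, $a\boxplus(b\boxplus c)=(a\boxplus b)\boxplus c$, $a\boxplus a'=\mathbf 1$, $a\boxplus\mathbf 0=a$, $a''=a$, $a\boxplus\mathbf 1=\mathbf 1$. Define $a\odot b=(a'\boxplus b')'$, $a\sqcap b=(a\boxplus b')\odot b$, $a\sqcup b=(a\odot b')\boxplus b$. An MV algebra is an S-algebra satisfying $(a'\boxplus b)'\boxplus b=(a\boxplus b')'\boxplus a$. A QMV algebra is an S-algebra satisfying: $a\sqcup(b\sqcap a)=a$; $(a\sqcap b)\sqcap c=(a\sqcap b)\sqcap(b\sqcap c)$; $a\boxplus[b\sqcap(a\boxplus c)']=(a\boxplus b)\sqcap(a\boxplus(a\boxplus c)')$; $a\boxplus(a'\sqcap b)=a\boxplus b$; $(a'\boxplus b)\sqcup(b'\boxplus a)=\mathbf 1$. Its order is $a\le b$ iff $a=a\sqcap b$; it is lattice-ordered if $(E,\le)$ is a lattice, with meet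 $\wedge$ (arbitrary meets below are over the relevant sets, which the paper asserts reduce to finite meets). An $\mathcal{E}$-valued non-deterministic Turing machine ($\mathcal{E}$NTM) is $M=(Q,\Sigma,\Gamma,\delta,B,I,T)$ where $Q$ is a finite nonempty state set, $\Sigma$ a finite input alphabet, $\Gamma$ a finite tape alphabet containing the blank $B$ with $\Sigma\subseteq\Gamma\setminus\{B\}$, $\delta:Q\times\Gamma\times Q\times\Gamma\times\{L,S,R\}\to E$ the transition function, $I:Q\to E$ the initial-state function and $T:Q\to E$ the final-state function. (Value $\mathbf 0$ is "fully true", $\mathbf 1$ "fully false"/absent.) An instantaneous description (ID) is $C=\alpha_1 q\alpha_2$ with $q\in Q$ and $\alpha_1\alpha_2$ the tape contents between the leftmost and rightmost nonblank symbols, the head reading the first symbol of $\alpha_2$; $St(C)=q$. For IDs $C_1,C_2$: $\delta^\star(C_1,C_2)=\delta(p,a,q,b,L)$ if $C_1=\alpha cpa\beta$, $C_2=\alpha qcb\beta$; $=\delta(p,a,q,b,S)$ if $C_1=\alpha pa\beta$, $C_2=\alpha qb\beta$; $=\delta(p,a,q,b,R)$ if $C_1=\alpha pa\beta$, $C_2=\alpha bq\beta$; and $=\mathbf 1$ otherwise. The machine halts along a path when it reaches a state $q$ with $T(q)<\mathbf 1$, or an ID $C$ with $T(St(C))=\mathbf 1$ and $\delta^\star(C,C')=\mathbf 1$ for all IDs $C'$; only halting paths are taken into account, and the value on $s$ is undefined if no path halts. Depth-first language: $|M|_d(s)=\bigwedge_{n\ge1}\bigwedge_{C_1,\dots,C_n}\bigwedge_{q_0\in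 Q} I(q_0)\boxplus\delta^\star(q_0s,C_1)\boxplus\delta^\star(C_1,C_2)\boxplus\cdots\boxplus\delta^\star(C_{n-1},C_n)\boxplus T(St(C_n))$. Width-first language: $|M|_w(s)=\bigwedge_{n\ge1}\Big[\bigwedge_{C_n}\Big(\cdots\Big(\bigwedge_{C_2}\Big(\bigwedge_{C_1}\big(\bigwedge_{q_0}I(q_0)\boxplus\delta^\star(q_0s,C_1)\big)\boxplus\delta^\star(C_1,C_2)\Big)\boxplus\delta^\star(C_2,C_3)\Big)\cdots\Big)\boxplus T(St(C_n))\Big]$, for $s\in\Sigma^+$. -}

module Defs where

open import Data.Nat using (ℕ; zero; suc)
open import Data.Fin using (Fin) renaming (_≟_ to _≟F_)
open import Data.List using (List; []; _∷_; reverse; map)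
open import Data.List.NonEmpty using (List⁺; toList)
open import Data.List.Properties using (≡-dec)
open import Data.Maybe using (Maybe; just; nothing)
open import Data.Bool using (Bool; true; false; if_then_else_) renaming (_∧_ to _&&_)
open import Data.Product using (Σ; _×_; _,_)
open import Relation.Nullary using (does; ¬_)
open import Relation.Binary.PropositionalEquality using (_≡_)
open import Function.Definitions using (Injective)

record LQMV : Set₁ where
  infixl 6 _⊞_
  field
    E     : Set
    _⊞_   : E → E → E
    _′    : E → E
    𝟎 𝟏   : E
    ⊞-comm   : ∀ a b → a ⊞ b ≡ b ⊞ a
    ⊞-assoc  : ∀ a b c → a ⊞ (b ⊞ c) ≡ (a ⊞ b) ⊞ c
    ⊞-compl  : ∀ a → a ⊞ (a ′) ≡ 𝟏
    ⊞-unit   : ∀ a → a ⊞ 𝟎 ≡ a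
    ′-invol  : ∀ a → (a ′) ′ ≡ a
    ⊞-absorb : ∀ a → a ⊞ 𝟏 ≡ 𝟏

  _⊙_ : E → E → E
  a ⊙ b = ((a ′) ⊞ (b ′)) ′

  _⊓_ : E → E → E
  a ⊓ b = (a ⊞ (b ′)) ⊙ b

  _⊔_ : E → E → E
  a ⊔ b = (a ⊙ (b ′)) ⊞ b

  field
    qmv1 : ∀ a b → a ⊔ (b ⊓ a) ≡ a
    qmv2 : ∀ a b c → (a ⊓ b) ⊓ c ≡ (a ⊓ b) ⊓ (b ⊓ c)
    qmv3 : ∀ a b c → a ⊞ (b ⊓ ((a ⊞ c) ′)) ≡ (a ⊞ b) ⊓ (a ⊞ ((a ⊞ c) ′))
    qmv4 : ∀ a b → a ⊞ ((a ′) ⊓ b) ≡ a ⊞ b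
    qmv5 : ∀ a b → ((a ′) ⊞ b) ⊔ ((b ′) ⊞ a) ≡ 𝟏

  _≤_ : E → E → Set
  a ≤ b = a ≡ a ⊓ b

  field
    _∧_ : E → E → E
    _∨_ : E → E → E
    ∧-lb₁ : ∀ a b → (a ∧ b) ≤ a
    ∧-lb₂ : ∀ a b → (a ∧ b) ≤ b
    ∧-glb : ∀ a b c → c ≤ a → c ≤ b → c ≤ (a ∧ b)
    ∨-ub₁ : ∀ a b → a ≤ (a ∨ b)
    ∨-ub₂ : ∀ a b → b ≤ (a ∨ b)
    ∨-lub : ∀ a b c → a ≤ c → b ≤ c → (a ∨ b) ≤ c

  IsMeet : {I : Set} → (I → E) → E → Set
  IsMeet {I} f m = (∀ i → m ≤ f i) × (∀ x → (∀ i → x ≤ f i) → x ≤ m)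

IsMV : LQMV → Set
IsMV 𝓔 = ∀ a b → ((a ′) ⊞ b) ′ ⊞ b ≡ (a ⊞ (b ′)) ′ ⊞ a
  where open LQMV 𝓔

data Dir : Set where
  L S R : Dir

record ENTM (𝓔 : LQMV) : Set where
  open LQMV 𝓔 using (E)
  field
    kQ : ℕ            -- Q = Fin (suc kQ), finite and nonempty
    nΣ : ℕ
    nΓ : ℕ
    B  : Fin nΓ
    ι  : Fin nΣ → Fin nΓ                -- Σ ⊆ Γ ∖ {B}
    ι-inj : Injective _≡_ _≡_ ι
    ι-nb  : ∀ x → ¬ (ι x ≡ B)
    δ  : Fin (suc kQ) → Fin nΓ → Fin (suc kQ) → Fin nΓ → Dir → E
    I  : Fin (suc kQ) → E
    T  : Fin (suc kQ) → E

module Machine {𝓔 : LQMV} (M : ENTM 𝓔) where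
  open LQMV 𝓔
  open ENTM M

  Q Γ Σₘ : Set
  Q = Fin (suc kQ)
  Γ = Fin nΓ
  Σₘ = Fin nΣ

  -- instantaneous description α₁ q α₂ (head on the first symbol of α₂)
  ID : Set
  ID = List Γ × Q × List Γ

  St : ID → Q
  St (_ , q , _) = q

  private
    _≟L_ : (x y : List Γ) → Bool
    x ≟L y = does (≡-dec _≟F_ x y)

    _≟Γ_ : (x y : Γ) → Bool
    x ≟Γ y = does (x ≟F y)

    -- C₁ = α c p a β , C₂ = α q c b β
    tryL : List Γ → Q → Γ → List Γ → List Γ → Q → List Γ → Maybe E
    tryL l₁ p a β l₂ q r₂ with reverse l₁ | r₂
    ... | c ∷ rα | c′ ∷ b ∷ β′ =
          if (c ≟Γ c′) && ((l₂ ≟L reverse rα) && (β′ ≟L β))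
          then just (δ p a q b L) else nothing
    ... | _ | _ = nothing

    -- C₁ = α p a β , C₂ = α q b β
    tryS : List Γ → Q → Γ → List Γ → List Γ → Q → List Γ → Maybe E
    tryS l₁ p a β l₂ q [] = nothing
    tryS l₁ p a β l₂ q (b ∷ β′) =
      if (l₂ ≟L l₁) && (β′ ≟L β) then just (δ p a q b S) else nothing

    -- C₁ = α p a β , C₂ = α b q β
    tryR : List Γ → Q → Γ → List Γ → List Γ → Q → List Γ → Maybe E
    tryR l₁ p a β l₂ q r₂ with reverse l₂
    ... | [] = nothing
    ... | b ∷ rα =
          if (reverse rα ≟L l₁) && (r₂ ≟L β) then just (δ p a q b R) else nothing

    orElse : Maybe E → Maybe E → Maybe E
    orElse (just x) _ = just x
    orElse nothing y = y

    fromMaybe : Maybe E → E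
    fromMaybe (just x) = x
    fromMaybe nothing = 𝟏

  δ⋆ : ID → ID → E
  δ⋆ (l₁ , p , []) _ = 𝟏
  δ⋆ (l₁ , p , a ∷ β) (l₂ , q , r₂) =
    fromMaybe (orElse (tryL l₁ p a β l₂ q r₂)
              (orElse (tryS l₁ p a β l₂ q r₂) (tryR l₁ p a β l₂ q r₂)))

  initID : Q → List⁺ Σₘ → ID
  initID q₀ s = ([] , q₀ , map ι (toList s))

  chain : ID → List ID → E
  chain C [] = T (St C)
  chain C (D ∷ Ds) = δ⋆ C D ⊞ chain D Ds

  -- the family whose meet is |M|_d(s): indexed by q₀, C₁ and C₂…Cₙ (n ≥ 1)
  depthTerm : List⁺ Σₘ → Q × ID × List ID → E
  depthTerm s (q₀ , C₁ , Cs) = I q₀ ⊞ (δ⋆ (initID q₀ s) C₁ ⊞ chain C₁ Cs)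

  IsDepthValue : List⁺ Σₘ → E → Set
  IsDepthValue s d = IsMeet (depthTerm s) d

  -- W k C is the nested width-first meet at level k+1, ending in C = C_{k+1}
  IsWidthTable : List⁺ Σₘ → (ℕ → ID → E) → Set
  IsWidthTable s W =
    (∀ C → IsMeet (λ q₀ → I q₀ ⊞ δ⋆ (initID q₀ s) C) (W zero C)) ×
    (∀ k C → IsMeet (λ C′ → W k C′ ⊞ δ⋆ C′ C) (W (suc k) C))

  IsWidthValue : List⁺ Σₘ → E → Set
  IsWidthValue s w =
    Σ (ℕ → ID → E) λ W → IsWidthTable s W ×
    Σ (ℕ → E) λ u → (∀ k → IsMeet (λ C → W k C ⊞ T (St C)) (u k)) ×
    IsMeet u w

module Submission where

open import Defs
open import Data.Nat using (ℕ; zero; suc)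
open import Data.Fin using (Fin; zero; suc; _≟_)
open import Data.List using (List; []; _∷_; reverse)
open import Data.List.Properties using (≡-dec)
open import Data.List.NonEmpty using (List⁺; _∷_)
open import Data.Bool using (Bool; true; false) renaming (_∧_ to _&&_)
open import Data.Product using (_×_; _,_; proj₁; proj₂)
open import Relation.Nullary using (does)
open import Function.Bundles using (_⇔_; mk⇔)
open import Relation.Binary.PropositionalEquality

-- Both languages are meets of the same sums I q₀ ⊞ δ⋆ ⊞ … ⊞ δ⋆ ⊞ T; the width-first one
-- takes the partial meets early, and since (⋀ f) ⊞ t ≤ f i ⊞ t it can only be smaller.
-- Equality needs ⊞ to distribute over meets, (⋀ f) ⊞ t = ⋀ (f i ⊞ t). When ⊓ is
-- commutative, i.e. in MV algebras, x ≤ (x ⊙ t′) ⊞ t, and x ⊙ t′ is below every f i as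
-- soon as x is below every f i ⊞ t; this gives distributivity. Conversely, a three-state
-- machine with initial weights a and b has width-first value (a ∧ b) ⊞ a′ and depth-first
-- value b ⊞ a′ on a one-letter input; multiplying both by a turns their equality into
-- b ⊓ a = a ∧ b, so ⊓ is commutative.

module QMVProperties (𝓔 : LQMV) where
  open LQMV 𝓔
  open ≡-Reasoning

  ⊞-unitˡ : ∀ a → 𝟎 ⊞ a ≡ a
  ⊞-unitˡ a = trans (⊞-comm 𝟎 a) (⊞-unit a)

  ⊞-absorbˡ : ∀ a → 𝟏 ⊞ a ≡ 𝟏
  ⊞-absorbˡ a = trans (⊞-comm 𝟏 a) (⊞-absorb a)

  ′-injective : ∀ {a b} → a ′ ≡ b ′ → a ≡ b
  ′-injective {a} {b} e = trans (sym (′-invol a)) (trans (cong _′ e) (′-invol b))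

  𝟎′≡𝟏 : 𝟎 ′ ≡ 𝟏
  𝟎′≡𝟏 = trans (sym (⊞-unitˡ (𝟎 ′))) (⊞-compl 𝟎)

  𝟏′≡𝟎 : 𝟏 ′ ≡ 𝟎
  𝟏′≡𝟎 = ′-injective (trans (′-invol 𝟏) (sym 𝟎′≡𝟏))

  ⊙-comm : ∀ a b → a ⊙ b ≡ b ⊙ a
  ⊙-comm a b = cong _′ (⊞-comm (a ′) (b ′))

  ⊙-assoc : ∀ a b c → (a ⊙ b) ⊙ c ≡ a ⊙ (b ⊙ c)
  ⊙-assoc a b c = cong _′ (begin
    ((a ′ ⊞ b ′) ′) ′ ⊞ c ′  ≡⟨ cong (_⊞ c ′) (′-invol _) ⟩
    (a ′ ⊞ b ′) ⊞ c ′        ≡⟨ ⊞-assoc _ _ _ ⟨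
    a ′ ⊞ (b ′ ⊞ c ′)        ≡⟨ cong (a ′ ⊞_) (′-invol _) ⟨
    a ′ ⊞ ((b ′ ⊞ c ′) ′) ′  ∎)

  ⊙-unitʳ : ∀ a → a ⊙ 𝟏 ≡ a
  ⊙-unitʳ a = begin
    (a ′ ⊞ 𝟏 ′) ′  ≡⟨ cong (λ z → (a ′ ⊞ z) ′) 𝟏′≡𝟎 ⟩
    (a ′ ⊞ 𝟎) ′    ≡⟨ cong _′ (⊞-unit (a ′)) ⟩
    a ′ ′          ≡⟨ ′-invol a ⟩
    a              ∎

  ⊙-unitˡ : ∀ a → 𝟏 ⊙ a ≡ a
  ⊙-unitˡ a = trans (⊙-comm 𝟏 a) (⊙-unitʳ a)

  ⊙-compl : ∀ a → a ⊙ (a ′) ≡ 𝟎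
  ⊙-compl a = trans (cong _′ (⊞-compl (a ′))) 𝟏′≡𝟎

  ⊙-complˡ : ∀ a → (a ′) ⊙ a ≡ 𝟎
  ⊙-complˡ a = trans (⊙-comm (a ′) a) (⊙-compl a)

  ⊙-absorb : ∀ a → a ⊙ 𝟎 ≡ 𝟎
  ⊙-absorb a = begin
    (a ′ ⊞ 𝟎 ′) ′  ≡⟨ cong (λ z → (a ′ ⊞ z) ′) 𝟎′≡𝟏 ⟩
    (a ′ ⊞ 𝟏) ′    ≡⟨ cong _′ (⊞-absorb (a ′)) ⟩
    𝟏 ′            ≡⟨ 𝟏′≡𝟎 ⟩
    𝟎              ∎

  ⊓-′ : ∀ a b → (a ⊓ b) ′ ≡ (a ⊞ b ′) ′ ⊞ b ′
  ⊓-′ a b = ′-invol _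

  ≤-refl : ∀ a → a ≤ a
  ≤-refl a = sym (trans (cong (_⊙ a) (⊞-compl a)) (⊙-unitˡ a))

  ≤-reflexive : ∀ {a b} → a ≡ b → a ≤ b
  ≤-reflexive {a} refl = ≤-refl a

  ≤-𝟏 : ∀ a → a ≤ 𝟏
  ≤-𝟏 a = sym (begin
    (a ⊞ 𝟏 ′) ⊙ 𝟏  ≡⟨ ⊙-unitʳ _ ⟩
    a ⊞ 𝟏 ′        ≡⟨ cong (a ⊞_) 𝟏′≡𝟎 ⟩
    a ⊞ 𝟎          ≡⟨ ⊞-unit a ⟩
    a              ∎)

  𝟎-≤ : ∀ a → 𝟎 ≤ a
  𝟎-≤ a = sym (trans (cong (_⊙ a) (⊞-unitˡ (a ′))) (⊙-complˡ a))

  ≤-trans : ∀ {a b c} → a ≤ b → b ≤ c → a ≤ c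
  ≤-trans {a} {b} {c} a≤b b≤c = begin
    a                  ≡⟨ a≤b ⟩
    a ⊓ b              ≡⟨ cong (_⊓ b) a≤b ⟩
    (a ⊓ b) ⊓ b        ≡⟨ cong ((a ⊓ b) ⊓_) b≤c ⟩
    (a ⊓ b) ⊓ (b ⊓ c)  ≡⟨ qmv2 a b c ⟨
    (a ⊓ b) ⊓ c        ≡⟨ cong (_⊓ c) a≤b ⟨
    a ⊓ c              ∎

  x≤y⇒x⊔y≡y : ∀ {a b} → a ≤ b → a ⊔ b ≡ b
  x≤y⇒x⊔y≡y {a} {b} a≤b = begin
    (a ⊙ (b ′)) ⊞ b                ≡⟨ cong (λ z → (z ⊙ (b ′)) ⊞ b) a≤b ⟩
    (((a ⊞ b ′) ⊙ b) ⊙ (b ′)) ⊞ b  ≡⟨ cong (_⊞ b) (⊙-assoc _ _ _) ⟩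
    ((a ⊞ b ′) ⊙ (b ⊙ (b ′))) ⊞ b  ≡⟨ cong (λ z → ((a ⊞ b ′) ⊙ z) ⊞ b) (⊙-compl b) ⟩
    ((a ⊞ b ′) ⊙ 𝟎) ⊞ b            ≡⟨ cong (_⊞ b) (⊙-absorb _) ⟩
    𝟎 ⊞ b                          ≡⟨ ⊞-unitˡ b ⟩
    b                              ∎

  y≤x⇒x⊔y≡x : ∀ {a b} → b ≤ a → a ⊔ b ≡ a
  y≤x⇒x⊔y≡x {a} {b} b≤a = trans (cong (a ⊔_) b≤a) (qmv1 a b)

  ≤-antisym : ∀ {a b} → a ≤ b → b ≤ a → a ≡ b
  ≤-antisym a≤b b≤a = trans (sym (y≤x⇒x⊔y≡x b≤a)) (x≤y⇒x⊔y≡y a≤b)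

  ⊞-⊓-compl : ∀ a c → c ⊞ (a ⊓ (c ′)) ≡ c ⊞ a
  ⊞-⊓-compl a c = begin
    c ⊞ (a ⊓ (c ′))            ≡⟨ cong (λ z → c ⊞ (a ⊓ (z ′))) (⊞-unit c) ⟨
    c ⊞ (a ⊓ ((c ⊞ 𝟎) ′))      ≡⟨ qmv3 c a 𝟎 ⟩
    (c ⊞ a) ⊓ (c ⊞ (c ⊞ 𝟎) ′)  ≡⟨ cong (λ z → (c ⊞ a) ⊓ (c ⊞ z ′)) (⊞-unit c) ⟩
    (c ⊞ a) ⊓ (c ⊞ c ′)        ≡⟨ cong ((c ⊞ a) ⊓_) (⊞-compl c) ⟩
    (c ⊞ a) ⊓ 𝟏                ≡⟨ ≤-𝟏 _ ⟨
    c ⊞ a                      ∎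

  ⊞-monoʳ-≤ : ∀ {a b} c → a ≤ b → (c ⊞ a) ≤ (c ⊞ b)
  ⊞-monoʳ-≤ {a} {b} c a≤b = begin
    c ⊞ a                        ≡⟨ ⊞-⊓-compl a c ⟨
    c ⊞ (a ⊓ (c ′))              ≡⟨ cong (λ z → c ⊞ (z ⊓ (c ′))) a≤b ⟩
    c ⊞ ((a ⊓ b) ⊓ (c ′))        ≡⟨ cong (c ⊞_) (qmv2 a b (c ′)) ⟩
    c ⊞ ((a ⊓ b) ⊓ (b ⊓ (c ′)))  ≡⟨ cong (λ z → c ⊞ (z ⊓ (b ⊓ (c ′)))) a≤b ⟨
    c ⊞ (a ⊓ (b ⊓ (c ′)))        ≡⟨ cong (λ z → c ⊞ (a ⊓ z)) b⊓c′≡ ⟨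
    c ⊞ (a ⊓ ((c ⊞ e) ′))        ≡⟨ qmv3 c a e ⟩
    (c ⊞ a) ⊓ (c ⊞ (c ⊞ e) ′)    ≡⟨ cong (λ z → (c ⊞ a) ⊓ (c ⊞ z)) b⊓c′≡ ⟩
    (c ⊞ a) ⊓ (c ⊞ (b ⊓ (c ′)))  ≡⟨ cong ((c ⊞ a) ⊓_) (⊞-⊓-compl b c) ⟩
    (c ⊞ a) ⊓ (c ⊞ b)            ∎
    where
    -- qmv3 applies once b ⊓ c′ is written in the form (c ⊞ e)′
    e : E
    e = (b ′) ⊙ (c ′)
    b⊓c′≡ : (c ⊞ e) ′ ≡ b ⊓ (c ′)
    b⊓c′≡ = cong _′ (begin
      c ⊞ (b ′ ′ ⊞ c ′ ′) ′  ≡⟨ cong (λ z → c ⊞ (z ⊞ c ′ ′) ′) (′-invol b) ⟩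
      c ⊞ (b ⊞ c ′ ′) ′      ≡⟨ ⊞-comm _ _ ⟩
      (b ⊞ c ′ ′) ′ ⊞ c      ≡⟨ cong ((b ⊞ c ′ ′) ′ ⊞_) (′-invol c) ⟨
      (b ⊞ c ′ ′) ′ ⊞ c ′ ′  ∎)

  ⊞-monoˡ-≤ : ∀ {a b} c → a ≤ b → (a ⊞ c) ≤ (b ⊞ c)
  ⊞-monoˡ-≤ {a} {b} c a≤b = subst₂ _≤_ (⊞-comm c a) (⊞-comm c b) (⊞-monoʳ-≤ c a≤b)

  x≤y⊞x : ∀ a b → a ≤ (b ⊞ a)
  x≤y⊞x a b = subst (_≤ (b ⊞ a)) (⊞-unitˡ a) (⊞-monoˡ-≤ a (𝟎-≤ b))

  x≤x⊞y : ∀ a b → a ≤ (a ⊞ b)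
  x≤x⊞y a b = subst (a ≤_) (⊞-comm b a) (x≤y⊞x a b)

  ′-antitone : ∀ {a b} → a ≤ b → (b ′) ≤ (a ′)
  ′-antitone {a} {b} a≤b = begin
    b ′                      ≡⟨ cong _′ (y≤x⇒x⊔y≡x a≤b) ⟨
    ((b ⊙ (a ′)) ⊞ a) ′      ≡⟨ cong (λ z → ((b ⊙ (a ′)) ⊞ z) ′) (′-invol a) ⟨
    ((b ⊙ (a ′)) ⊞ a ′ ′) ′  ∎

  ⊙-monoˡ-≤ : ∀ {a b} c → a ≤ b → (a ⊙ c) ≤ (b ⊙ c)
  ⊙-monoˡ-≤ c a≤b = ′-antitone (⊞-monoˡ-≤ (c ′) (′-antitone a≤b))

  x⊓y≤y : ∀ a b → (a ⊓ b) ≤ b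
  x⊓y≤y a b = begin
    a ⊓ b              ≡⟨ ≤-𝟏 _ ⟩
    (a ⊓ b) ⊓ 𝟏        ≡⟨ qmv2 a b 𝟏 ⟩
    (a ⊓ b) ⊓ (b ⊓ 𝟏)  ≡⟨ cong ((a ⊓ b) ⊓_) (≤-𝟏 b) ⟨
    (a ⊓ b) ⊓ b        ∎

  ∧-comm : ∀ a b → a ∧ b ≡ b ∧ a
  ∧-comm a b = ≤-antisym (swap a b) (swap b a)
    where
    swap : ∀ a b → (a ∧ b) ≤ (b ∧ a)
    swap a b = ∧-glb b a (a ∧ b) (∧-lb₂ a b) (∧-lb₁ a b)

  ∧-idem : ∀ a → a ∧ a ≡ a
  ∧-idem a = ≤-antisym (∧-lb₁ a a) (∧-glb a a a (≤-refl a) (≤-refl a))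

  isMeet-𝟏 : ∀ {I : Set} {f : I → E} → (∀ i → f i ≡ 𝟏) → IsMeet f 𝟏
  isMeet-𝟏 f≡𝟏 = (λ i → ≤-reflexive (sym (f≡𝟏 i))) , (λ x _ → ≤-𝟏 x)

  MV⇒⊓-comm : IsMV 𝓔 → ∀ a b → a ⊓ b ≡ b ⊓ a
  MV⇒⊓-comm mv a b = ′-injective (begin
    (a ⊓ b) ′              ≡⟨ ⊓-′ a b ⟩
    (a ⊞ b ′) ′ ⊞ b ′      ≡⟨ cong (λ z → (z ⊞ b ′) ′ ⊞ b ′) (′-invol a) ⟨
    (a ′ ′ ⊞ b ′) ′ ⊞ b ′  ≡⟨ mv (a ′) (b ′) ⟩
    (a ′ ⊞ b ′ ′) ′ ⊞ a ′  ≡⟨ cong (λ z → z ′ ⊞ a ′) (⊞-comm (a ′) (b ′ ′)) ⟩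
    (b ′ ′ ⊞ a ′) ′ ⊞ a ′  ≡⟨ cong (λ z → (z ⊞ a ′) ′ ⊞ a ′) (′-invol b) ⟩
    (b ⊞ a ′) ′ ⊞ a ′      ≡⟨ ⊓-′ b a ⟨
    (b ⊓ a) ′              ∎)

  ⊓-comm⇒MV : (∀ a b → a ⊓ b ≡ b ⊓ a) → IsMV 𝓔
  ⊓-comm⇒MV ⊓-comm a b = begin
    (a ′ ⊞ b) ′ ⊞ b          ≡⟨ cong₂ (λ u v → (a ′ ⊞ u) ′ ⊞ v) (′-invol b) (′-invol b) ⟨
    (a ′ ⊞ b ′ ′) ′ ⊞ b ′ ′  ≡⟨ ⊓-′ (a ′) (b ′) ⟨
    ((a ′) ⊓ (b ′)) ′        ≡⟨ cong _′ (⊓-comm (a ′) (b ′)) ⟩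
    ((b ′) ⊓ (a ′)) ′        ≡⟨ ⊓-′ (b ′) (a ′) ⟩
    (b ′ ⊞ a ′ ′) ′ ⊞ a ′ ′  ≡⟨ cong₂ (λ u v → (b ′ ⊞ u) ′ ⊞ v) (′-invol a) (′-invol a) ⟩
    (b ′ ⊞ a) ′ ⊞ a          ≡⟨ cong (λ z → z ′ ⊞ a) (⊞-comm (b ′) a) ⟩
    (a ⊞ b ′) ′ ⊞ a          ∎

  module ⊓-Commutative (⊓-comm : ∀ a b → a ⊓ b ≡ b ⊓ a) where

    x⊓y≤x : ∀ a b → (a ⊓ b) ≤ a
    x⊓y≤x a b = subst (_≤ a) (⊓-comm b a) (x⊓y≤y b a)

    ⊔-comm : ∀ a b → a ⊔ b ≡ b ⊔ a
    ⊔-comm a b = ′-injective (begin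
      (a ⊔ b) ′                ≡⟨ cong (λ z → ((a ⊙ (b ′)) ⊞ z) ′) (′-invol b) ⟨
      ((a ⊙ (b ′)) ⊞ b ′ ′) ′  ≡⟨ ⊓-comm (a ′) (b ′) ⟩
      ((b ⊙ (a ′)) ⊞ a ′ ′) ′  ≡⟨ cong (λ z → ((b ⊙ (a ′)) ⊞ z) ′) (′-invol a) ⟩
      (b ⊔ a) ′                ∎)

    x≤x⊔y : ∀ a b → a ≤ (a ⊔ b)
    x≤x⊔y a b = subst (a ≤_) (⊔-comm b a) (x≤y⊞x a (b ⊙ (a ′)))

    ⊞-meet-greatest : ∀ {I : Set} {f : I → E} {m} → IsMeet f m →
                      ∀ x t → (∀ i → x ≤ (f i ⊞ t)) → x ≤ (m ⊞ t)
    ⊞-meet-greatest {f = f} {m} (_ , greatest) x t x≤fᵢ⊞t =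
      ≤-trans (x≤x⊔y x t) (⊞-monoˡ-≤ t (greatest (x ⊙ (t ′)) x⊙t′≤fᵢ))
      where
      x⊙t′≤fᵢ : ∀ i → (x ⊙ (t ′)) ≤ f i
      x⊙t′≤fᵢ i = ≤-trans (⊙-monoˡ-≤ (t ′) (x≤fᵢ⊞t i))
        (subst (λ z → ((f i ⊞ z) ⊙ (t ′)) ≤ f i) (′-invol t) (x⊓y≤x (f i) (t ′)))

module Transitions {𝓔 : LQMV} (M : ENTM 𝓔) where
  open LQMV 𝓔
  open ENTM M
  open Machine M

  private
    _≟ᴸ_ : List Γ → List Γ → Bool
    x ≟ᴸ y = does (≡-dec _≟_ x y)

  -- the case split follows the order in which δ⋆ tries the moves L, S and R
  δ⋆≡𝟏 : ∀ C D → (∀ a b d → δ (St C) a (St D) b d ≡ 𝟏) → δ⋆ C D ≡ 𝟏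
  δ⋆≡𝟏 (l₁ , p , []) D h = refl
  δ⋆≡𝟏 (l₁ , p , a ∷ β) (l₂ , q , r₂) h with reverse l₁ | reverse l₂ | r₂
  ... | [] | [] | [] = refl
  ... | _ ∷ _ | [] | [] = refl
  ... | [] | [] | b ∷ β′ with (l₂ ≟ᴸ l₁) && (β′ ≟ᴸ β)
  ...   | true = h _ _ _
  ...   | false = refl
  δ⋆≡𝟏 (l₁ , p , a ∷ β) (l₂ , q , r₂) h | [] | _ ∷ rα₂ | [] with (reverse rα₂ ≟ᴸ l₁) && ([] ≟ᴸ β)
  ...   | true = h _ _ _
  ...   | false = refl
  δ⋆≡𝟏 (l₁ , p , a ∷ β) (l₂ , q , r₂) h | _ ∷ _ | _ ∷ rα₂ | [] with (reverse rα₂ ≟ᴸ l₁) && ([] ≟ᴸ β)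
  ...   | true = h _ _ _
  ...   | false = refl
  δ⋆≡𝟏 (l₁ , p , a ∷ β) (l₂ , q , r₂) h | [] | _ ∷ rα₂ | b ∷ β′
    with (l₂ ≟ᴸ l₁) && (β′ ≟ᴸ β) | (reverse rα₂ ≟ᴸ l₁) && ((b ∷ β′) ≟ᴸ β)
  ...   | true | _ = h _ _ _
  ...   | false | true = h _ _ _
  ...   | false | false = refl
  δ⋆≡𝟏 (l₁ , p , a ∷ β) (l₂ , q , r₂) h | c ∷ rα | [] | c′ ∷ [] with (l₂ ≟ᴸ l₁) && ([] ≟ᴸ β)
  ...   | true = h _ _ _
  ...   | false = refl
  δ⋆≡𝟏 (l₁ , p , a ∷ β) (l₂ , q , r₂) h | c ∷ rα | [] | c′ ∷ b ∷ β′
    with does (c ≟ c′) && ((l₂ ≟ᴸ reverse rα) && (β′ ≟ᴸ β)) | (l₂ ≟ᴸ l₁) && ((b ∷ β′) ≟ᴸ β)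
  ...   | true | _ = h _ _ _
  ...   | false | true = h _ _ _
  ...   | false | false = refl
  δ⋆≡𝟏 (l₁ , p , a ∷ β) (l₂ , q , r₂) h | c ∷ rα | _ ∷ rα₂ | c′ ∷ []
    with (l₂ ≟ᴸ l₁) && ([] ≟ᴸ β) | (reverse rα₂ ≟ᴸ l₁) && ((c′ ∷ []) ≟ᴸ β)
  ...   | true | _ = h _ _ _
  ...   | false | true = h _ _ _
  ...   | false | false = refl
  δ⋆≡𝟏 (l₁ , p , a ∷ β) (l₂ , q , r₂) h | c ∷ rα | _ ∷ rα₂ | c′ ∷ b ∷ β′
    with does (c ≟ c′) && ((l₂ ≟ᴸ reverse rα) && (β′ ≟ᴸ β)) | (l₂ ≟ᴸ l₁) && ((b ∷ β′) ≟ᴸ β)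
       | (reverse rα₂ ≟ᴸ l₁) && ((c′ ∷ b ∷ β′) ≟ᴸ β)
  ...   | true | _ | _ = h _ _ _
  ...   | false | true | _ = h _ _ _
  ...   | false | false | true = h _ _ _
  ...   | false | false | false = refl

module Runs {𝓔 : LQMV} (M : ENTM 𝓔) (s : List⁺ (Machine.Σₘ M)) where
  open LQMV 𝓔
  open ENTM M
  open Machine M
  open QMVProperties 𝓔

  -- Run k C: a computation of k + 1 steps on s ending in C; its cost is summed from the
  -- left, as in the width-first recursion
  data Run : ℕ → ID → Set where
    start : (q₀ : Q) (C : ID) → Run zero C
    _▸_   : ∀ {k C} → Run k C → (D : ID) → Run (suc k) D

  cost : ∀ {k C} → Run k C → E
  cost (start q₀ C) = I q₀ ⊞ δ⋆ (initID q₀ s) C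
  cost (_▸_ {C = C} r D) = cost r ⊞ δ⋆ C D

  cost-▸-⊞ : ∀ {k C} (r : Run k C) D t → cost (r ▸ D) ⊞ t ≡ cost r ⊞ (δ⋆ C D ⊞ t)
  cost-▸-⊞ r D t = sym (⊞-assoc _ _ _)

  depthTerm≡cost-start : ∀ q₀ C Ds → depthTerm s (q₀ , C , Ds) ≡ cost (start q₀ C) ⊞ chain C Ds
  depthTerm≡cost-start q₀ C Ds = ⊞-assoc _ _ _

  width-≤-cost : ∀ {W} → IsWidthTable s W → ∀ {k C} (r : Run k C) → W k C ≤ cost r
  width-≤-cost (first , _) (start q₀ C) = proj₁ (first C) q₀
  width-≤-cost table@(_ , next) (_▸_ {k} {C} r D) =
    ≤-trans (proj₁ (next k D) C) (⊞-monoˡ-≤ (δ⋆ C D) (width-≤-cost table r))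

  width-≤-depth : ∀ {w d} → IsWidthValue s w → IsDepthValue s d → w ≤ d
  width-≤-depth {w} (_ , table , _ , uMeet , wMeet) (_ , greatest) =
    greatest w λ (q₀ , C , Ds) →
      subst (w ≤_) (sym (depthTerm≡cost-start q₀ C Ds)) (w≤cost⊞chain (start q₀ C) Ds)
    where
    w≤cost⊞chain : ∀ {k C} (r : Run k C) Ds → w ≤ (cost r ⊞ chain C Ds)
    w≤cost⊞chain {k} {C} r [] =
      ≤-trans (proj₁ wMeet k)
        (≤-trans (proj₁ (uMeet k) C) (⊞-monoˡ-≤ (T (St C)) (width-≤-cost table r)))
    w≤cost⊞chain r (D ∷ Ds) =
      subst (w ≤_) (cost-▸-⊞ r D (chain D Ds)) (w≤cost⊞chain (r ▸ D) Ds)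

  module _ (⊓-comm : ∀ a b → a ⊓ b ≡ b ⊓ a) where
    open ⊓-Commutative ⊓-comm

    width-greatest : ∀ {W} → IsWidthTable s W → ∀ k C t x →
                     (∀ (r : Run k C) → x ≤ (cost r ⊞ t)) → x ≤ (W k C ⊞ t)
    width-greatest (first , _) zero C t x x≤ =
      ⊞-meet-greatest (first C) x t (λ q₀ → x≤ (start q₀ C))
    width-greatest table@(_ , next) (suc k) C t x x≤ =
      ⊞-meet-greatest (next k C) x t λ C′ →
        subst (x ≤_) (⊞-assoc _ _ _)
          (width-greatest table k C′ (δ⋆ C′ C ⊞ t) x λ r →
            subst (x ≤_) (cost-▸-⊞ r C t) (x≤ (r ▸ C)))

    depth-≤-width : ∀ {w d} → IsWidthValue s w → IsDepthValue s d → d ≤ w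
    depth-≤-width {d = d} (_ , table , _ , uMeet , wMeet) (lowerBound , _) =
      proj₂ wMeet d λ k → proj₂ (uMeet k) d λ C →
        width-greatest table k C (T (St C)) d λ r → d≤cost⊞chain r []
      where
      d≤cost⊞chain : ∀ {k C} (r : Run k C) Ds → d ≤ (cost r ⊞ chain C Ds)
      d≤cost⊞chain (start q₀ C) Ds =
        subst (d ≤_) (depthTerm≡cost-start q₀ C Ds) (lowerBound (q₀ , C , Ds))
      d≤cost⊞chain (_▸_ {C = C} r D) Ds =
        subst (d ≤_) (sym (cost-▸-⊞ r D (chain D Ds))) (d≤cost⊞chain r (D ∷ Ds))

module MeetMachine (𝓔 : LQMV) (a b : LQMV.E 𝓔) where
  open LQMV 𝓔
  open QMVProperties 𝓔
  open ≡-Reasoning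

  pattern final = suc (suc zero)

  -- from state 0 (weight a) or 1 (weight b) the machine moves to final at no cost, and
  -- accepts there with weight a′
  δ₀ : Fin 3 → Fin 2 → Fin 3 → Fin 2 → Dir → E
  δ₀ final _ _     _ _ = 𝟏
  δ₀ _     _ final _ _ = 𝟎
  δ₀ _     _ _     _ _ = 𝟏

  I₀ : Fin 3 → E
  I₀ zero       = a
  I₀ (suc zero) = b
  I₀ final      = 𝟏

  T₀ : Fin 3 → E
  T₀ final = a ′
  T₀ _     = 𝟏

  M : ENTM 𝓔
  M = record
    { kQ = 2 ; nΣ = 1 ; nΓ = 2 ; B = zero ; ι = λ _ → suc zero
    ; ι-inj = λ { {zero} {zero} _ → refl } ; ι-nb = λ _ ()
    ; δ = δ₀ ; I = I₀ ; T = T₀ }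

  open Machine M
  open Transitions M

  s : List⁺ (Fin 1)
  s = zero ∷ []

  accepting : ID
  accepting = ([] , final , zero ∷ [])

  a′≤chain : ∀ C Ds → (a ′) ≤ chain C Ds
  a′≤chain (_ , zero , _)     []       = ≤-𝟏 _
  a′≤chain (_ , suc zero , _) []       = ≤-𝟏 _
  a′≤chain (_ , final , _)    []       = ≤-refl _
  a′≤chain C                  (D ∷ Ds) = ≤-trans (a′≤chain D Ds) (x≤y⊞x _ (δ⋆ C D))

  depth : IsDepthValue s (b ⊞ (a ′))
  depth = lowerBound , λ x x≤ →
    subst (λ z → x ≤ (b ⊞ z)) (⊞-unitˡ (a ′)) (x≤ (suc zero , accepting , []))
    where
    lowerBound : ∀ i → (b ⊞ (a ′)) ≤ depthTerm s i
    lowerBound (zero , C , Ds) =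
      ≤-trans (≤-𝟏 _) (subst (_≤ depthTerm s (zero , C , Ds)) (⊞-compl a)
        (⊞-monoʳ-≤ a (≤-trans (a′≤chain C Ds) (x≤y⊞x _ _))))
    lowerBound (suc zero , C , Ds) = ⊞-monoʳ-≤ b (≤-trans (a′≤chain C Ds) (x≤y⊞x _ _))
    lowerBound (final , C , Ds)    = ≤-trans (≤-𝟏 _) (x≤x⊞y 𝟏 _)

  W : ℕ → ID → E
  W zero    C = (a ⊞ δ⋆ (initID zero s) C) ∧ (b ⊞ δ⋆ (initID (suc zero) s) C)
  W (suc k) C = 𝟏

  W₀-unreachable : ∀ l q r → (∀ x y d → δ₀ zero x q y d ≡ 𝟏) →
                   (∀ x y d → δ₀ (suc zero) x q y d ≡ 𝟏) → W zero (l , q , r) ≡ 𝟏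
  W₀-unreachable l q r h₀ h₁ = begin
    (a ⊞ δ⋆ (initID zero s) C) ∧ (b ⊞ δ⋆ (initID (suc zero) s) C)
      ≡⟨ cong₂ (λ u v → (a ⊞ u) ∧ (b ⊞ v))
           (δ⋆≡𝟏 (initID zero s) C h₀) (δ⋆≡𝟏 (initID (suc zero) s) C h₁) ⟩
    (a ⊞ 𝟏) ∧ (b ⊞ 𝟏)  ≡⟨ cong₂ _∧_ (⊞-absorb a) (⊞-absorb b) ⟩
    𝟏 ∧ 𝟏              ≡⟨ ∧-idem 𝟏 ⟩
    𝟏                  ∎
    where
    C : ID
    C = (l , q , r)

  W-step≡𝟏 : ∀ k C′ C → W k C′ ⊞ δ⋆ C′ C ≡ 𝟏
  W-step≡𝟏 (suc k) C′ C = ⊞-absorbˡ _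
  W-step≡𝟏 zero C′@(l , zero , r) C =
    trans (cong (_⊞ δ⋆ C′ C) (W₀-unreachable l zero r (λ _ _ _ → refl) (λ _ _ _ → refl)))
      (⊞-absorbˡ _)
  W-step≡𝟏 zero C′@(l , suc zero , r) C =
    trans (cong (_⊞ δ⋆ C′ C) (W₀-unreachable l (suc zero) r (λ _ _ _ → refl) (λ _ _ _ → refl)))
      (⊞-absorbˡ _)
  W-step≡𝟏 zero C′@(_ , final , _) C =
    trans (cong (W zero C′ ⊞_) (δ⋆≡𝟏 C′ C (λ _ _ _ → refl))) (⊞-absorb _)

  table : IsWidthTable s W
  table = first , λ k C → isMeet-𝟏 (λ C′ → W-step≡𝟏 k C′ C)
    where
    first : ∀ C → IsMeet (λ q₀ → I₀ q₀ ⊞ δ⋆ (initID q₀ s) C) (W zero C)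
    first C = (λ { zero → ∧-lb₁ _ _
                 ; (suc zero) → ∧-lb₂ _ _
                 ; final → ≤-trans (≤-𝟏 _) (x≤x⊞y 𝟏 _) })
            , λ x x≤ → ∧-glb _ _ x (x≤ zero) (x≤ (suc zero))

  u : ℕ → E
  u zero    = (a ∧ b) ⊞ (a ′)
  u (suc k) = 𝟏

  uMeet : ∀ k → IsMeet (λ C → W k C ⊞ T₀ (St C)) (u k)
  uMeet (suc k) = isMeet-𝟏 (λ _ → ⊞-absorbˡ _)
  uMeet zero    = lowerBound , λ x x≤ →
    subst (λ z → x ≤ (z ⊞ (a ′))) (cong₂ _∧_ (⊞-unit a) (⊞-unit b)) (x≤ accepting)
    where
    lowerBound : ∀ C → u zero ≤ (W zero C ⊞ T₀ (St C))
    lowerBound (_ , zero , _)     = ≤-trans (≤-𝟏 _) (x≤y⊞x 𝟏 _)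
    lowerBound (_ , suc zero , _) = ≤-trans (≤-𝟏 _) (x≤y⊞x 𝟏 _)
    lowerBound (_ , final , _)    = ⊞-monoˡ-≤ (a ′)
      (∧-glb _ _ _ (≤-trans (∧-lb₁ a b) (x≤x⊞y a _)) (≤-trans (∧-lb₂ a b) (x≤x⊞y b _)))

  width : IsWidthValue s ((a ∧ b) ⊞ (a ′))
  width = W , table , u , uMeet , (λ { zero → ≤-refl _ ; (suc k) → ≤-𝟏 _ }) , λ x x≤ → x≤ zero

  width≡depth⇒⊓≡∧ : (∀ w d → IsWidthValue s w → IsDepthValue s d → w ≡ d) → b ⊓ a ≡ a ∧ b
  width≡depth⇒⊓≡∧ width≡depth = begin
    (b ⊞ (a ′)) ⊙ a        ≡⟨ cong (_⊙ a) (width≡depth _ _ width depth) ⟨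
    ((a ∧ b) ⊞ (a ′)) ⊙ a  ≡⟨ ∧-lb₁ a b ⟨
    a ∧ b                  ∎

WidthEqualsDepth : LQMV → Set
WidthEqualsDepth 𝓔 = ∀ (M : ENTM 𝓔) (s : List⁺ (Machine.Σₘ M)) (w d : LQMV.E 𝓔) →
  Machine.IsWidthValue M s w → Machine.IsDepthValue M s d → w ≡ d

widthEqualsDepth⇒MV : ∀ 𝓔 → WidthEqualsDepth 𝓔 → IsMV 𝓔
widthEqualsDepth⇒MV 𝓔 agree = ⊓-comm⇒MV λ a b → begin
  a ⊓ b  ≡⟨ ⊓≡∧ b a ⟩
  b ∧ a  ≡⟨ ∧-comm b a ⟩
  a ∧ b  ≡⟨ ⊓≡∧ a b ⟨
  b ⊓ a  ∎
  where
  open LQMV 𝓔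
  open QMVProperties 𝓔
  open ≡-Reasoning
  ⊓≡∧ : ∀ a b → b ⊓ a ≡ a ∧ b
  ⊓≡∧ a b = width≡depth⇒⊓≡∧ (agree M s)
    where open MeetMachine 𝓔 a b

MV⇒widthEqualsDepth : ∀ 𝓔 → IsMV 𝓔 → WidthEqualsDepth 𝓔
MV⇒widthEqualsDepth 𝓔 mv M s w d wv dv =
  ≤-antisym (width-≤-depth wv dv) (depth-≤-width (MV⇒⊓-comm mv) wv dv)
  where
  open QMVProperties 𝓔
  open Runs M s

proposition3p1 : (𝓔 : LQMV) →
    (∀ (M : ENTM 𝓔) (s : List⁺ (Machine.Σₘ M)) (w d : LQMV.E 𝓔) →
       Machine.IsWidthValue M s w → Machine.IsDepthValue M s d → LQMV._≤_ 𝓔 w d)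
    ×
    ((∀ (M : ENTM 𝓔) (s : List⁺ (Machine.Σₘ M)) (w d : LQMV.E 𝓔) →
       Machine.IsWidthValue M s w → Machine.IsDepthValue M s d → w ≡ d)
     ⇔ IsMV 𝓔)
proposition3p1 𝓔 =
  (λ M s w d → Runs.width-≤-depth M s) ,
  mk⇔ (widthEqualsDepth⇒MV 𝓔) (MV⇒widthEqualsDepth 𝓔)
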